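{- Let $d$ be a positive integer. If $\mathcal{F}\subseteq 2^{[n]}$ and $\mathrm{VCdim}(\mathcal{F})<d$, then $\ell(\mathcal{F})<2d$.
   Context: $[n]=\{1,\dots,n\}$ and $\ell(\mathcal{F})=\sum_{A\in\mathcal{F}}1/\binom{n}{|A|}$. A family $\mathcal{F}$ shatters $R\subseteq[n]$ if $\{A\cap R: A\in\mathcal{F}\}=2^R$. $\mathrm{VCdim}(\mathcal{F})$ is the maximum size of a subset of $[n]$ shattered by $\mathcal{F}$. -}

module Defs where

open import Data.Nat using (ℕ; zero; suc; _<_)
open import Data.Nat.Combinatorics using (_C_)
open import Data.Integer using (+_)
open import Data.Rational using (ℚ; _/_; _+_; 0ℚ)
open import Data.Fin.Subset using (Subset; _∩_; _⊆_; ∣_∣)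
open import Data.List using (List; foldr; map)
open import Data.List.Membership.Propositional using (_∈_)
open import Data.Product using (∃; _×_)
open import Relation.Binary.PropositionalEquality using (_≡_)

-- reciprocal of a natural number as a rational; 1/0 := 0 is never used
-- (binomial coefficients n C k with k ≤ n are ≥ 1).
recip : ℕ → ℚ
recip zero    = 0ℚ
recip (suc m) = + 1 / suc m

ℓ : ∀ {n} → List (Subset n) → ℚ
ℓ {n} F = foldr _+_ 0ℚ (map (λ A → recip (n C ∣ A ∣)) F)

Shatters : ∀ {n} → List (Subset n) → Subset n → Set
Shatters F R = ∀ S → S ⊆ R → ∃ λ A → A ∈ F × (A ∩ R) ≡ S

VCdimLessThan : ∀ {n} → List (Subset n) → ℕ → Set
VCdimLessThan F d = ∀ R → Shatters F R → ∣ R ∣ < d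

module Submission where

-- Everything is scaled by the common denominator D = 2ⁿ⁺¹ n!.  We build an
-- antitone weight w on subsets of [n], depending only on |A|, such that
--   w(A) + w(∁A) = D / C(n, |A|)                      (pairWeight-binomial),
-- namely w(A) = |A|! |∁A|! · lowerTail |A| |∁A|, where lowerTail a b counts the
-- subsets with at most b elements of an (a+b+1)-set.  Then
--   D · ℓ(F) = Σ_{A ∈ F} w(A) + Σ_{A ∈ F} w(∁A).
-- A weighted Pajor lemma (for an antitone weight, a family weighs at most as
-- much as the sets it shatters) bounds both halves, the second through the
-- complemented family, which shatters the same sets, by the weight of the sets
-- of size < d.  That weight is strictly below d · D, because each layer of
-- k-sets carries total pair weight w(A) + w(∁A) equal to D.

module WeightedShattering where

  open import Data.Bool using (Bool; true; false; not; _∧_; _∨_) renaming (_≟_ to _≟ᵇ_)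
  open import Data.Bool.Properties using (∧-zeroʳ; T-≡)
  open import Function.Bundles using (module Equivalence)
  open import Data.Nat using (ℕ; zero; suc; _+_; _*_; _^_; _∸_; _≤_; _<_; z≤n; s≤s; _!; _≡ᵇ_; _<ᵇ_; _<?_; _≤?_)
  open import Data.Nat.Combinatorics using (_C_; nCk≡n!/k![n-k]!; k>n⇒nCk≡0; k![n∸k]!∣n!; nCk+nC[k+1]≡[n+1]C[k+1])
  open import Data.Nat.DivMod using (m/n*n≡m)
  open import Data.Nat.Properties
  open import Data.Nat.Tactic.RingSolver using (solve-∀)
  open import Data.Vec using ([]; _∷_; here)
  open import Data.Vec.Properties using (∷-injective; ≡-dec)
  open import Data.Fin.Subset using (Subset; outside; inside; ∁; ⊥; _∩_; _⊆_; ∣_∣)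
  open import Data.Fin.Subset.Properties using (drop-∷-⊆; s⊆s; out⊆; ⊆-refl; p∩q⊆q; ∣p∣≤n; ∣⊥∣≡0; ∣∁p∣≡n∸∣p∣; ∪-∩-booleanAlgebra)
  import Algebra.Lattice.Properties.BooleanAlgebra as BooleanAlgebraProperties
  open import Data.Product using (∃; _×_; _,_; proj₁; proj₂)
  open import Data.List using (List; []; _∷_; map)
  open import Data.Nat.ListAction using (sum)
  open import Data.List.Relation.Unary.Any using (any?)
  open import Data.List.Relation.Unary.All.Properties using (All¬⇒¬Any)
  open import Data.List.Relation.Unary.AllPairs using ([]; _∷_)
  open import Data.List.Relation.Unary.Unique.Propositional using (Unique)
  open import Data.List.Membership.Propositional using (_∈_)
  open import Relation.Nullary using (Dec; contradiction; yes; no; does)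
  open import Relation.Binary.PropositionalEquality

  open import Defs

  [_]·_ : Bool → ℕ → ℕ
  [ true  ]· x = x
  [ false ]· x = 0

  []·-distrib-+ : ∀ b x y → [ b ]· (x + y) ≡ [ b ]· x + [ b ]· y
  []·-distrib-+ true  x y = refl
  []·-distrib-+ false x y = refl

  []·-mono : ∀ b {x y} → x ≤ y → [ b ]· x ≤ [ b ]· y
  []·-mono true  x≤y = x≤y
  []·-mono false x≤y = z≤n

  []·-strict : ∀ {b x y} → b ≡ true → x < y → [ b ]· x < [ b ]· y
  []·-strict refl x<y = x<y

  -- Exchange step of the shifting argument: when v ≤ u, moving the weight of
  -- two members to the union (weight u) and intersection (weight v) can only grow.
  []·-exchange : ∀ x y {u v} → v ≤ u → [ x ]· u + [ y ]· v ≤ [ x ∨ y ]· u + [ x ∧ y ]· v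
  []·-exchange true  true  v≤u = ≤-refl
  []·-exchange true  false v≤u = ≤-refl
  []·-exchange false true  v≤u = ≤-trans v≤u (m≤m+n _ 0)
  []·-exchange false false v≤u = ≤-refl

  sumSubsets : ∀ n → (Subset n → ℕ) → ℕ
  sumSubsets zero    f = f []
  sumSubsets (suc n) f = sumSubsets n (λ A → f (outside ∷ A)) + sumSubsets n (λ A → f (inside ∷ A))

  sumSubsets-cong : ∀ n {f g : Subset n → ℕ} → (∀ A → f A ≡ g A) → sumSubsets n f ≡ sumSubsets n g
  sumSubsets-cong zero    f≡g = f≡g []
  sumSubsets-cong (suc n) f≡g =
    cong₂ _+_ (sumSubsets-cong n (λ A → f≡g (outside ∷ A))) (sumSubsets-cong n (λ A → f≡g (inside ∷ A)))

  sumSubsets-mono : ∀ n {f g : Subset n → ℕ} → (∀ A → f A ≤ g A) → sumSubsets n f ≤ sumSubsets n g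
  sumSubsets-mono zero    f≤g = f≤g []
  sumSubsets-mono (suc n) f≤g =
    +-mono-≤ (sumSubsets-mono n (λ A → f≤g (outside ∷ A))) (sumSubsets-mono n (λ A → f≤g (inside ∷ A)))

  sumSubsets-strict : ∀ n {f g : Subset n → ℕ} → (∀ A → f A ≤ g A) → f ⊥ < g ⊥ →
    sumSubsets n f < sumSubsets n g
  sumSubsets-strict zero    f≤g f⊥<g⊥ = f⊥<g⊥
  sumSubsets-strict (suc n) f≤g f⊥<g⊥ =
    +-mono-<-≤ (sumSubsets-strict n (λ A → f≤g (outside ∷ A)) f⊥<g⊥) (sumSubsets-mono n (λ A → f≤g (inside ∷ A)))

  sumSubsets-+ : ∀ n (f g : Subset n → ℕ) → sumSubsets n (λ A → f A + g A) ≡ sumSubsets n f + sumSubsets n g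
  sumSubsets-+ zero    f g = refl
  sumSubsets-+ (suc n) f g = begin
    sumSubsets n (λ A → f (outside ∷ A) + g (outside ∷ A)) + sumSubsets n (λ A → f (inside ∷ A) + g (inside ∷ A))
      ≡⟨ cong₂ _+_ (sumSubsets-+ n _ _) (sumSubsets-+ n _ _) ⟩
    (f₀ + g₀) + (f₁ + g₁)
      ≡⟨ +-transpose f₀ g₀ f₁ g₁ ⟩
    (f₀ + f₁) + (g₀ + g₁)
      ∎
    where
    open ≡-Reasoning
    f₀ = sumSubsets n (λ A → f (outside ∷ A))
    f₁ = sumSubsets n (λ A → f (inside ∷ A))
    g₀ = sumSubsets n (λ A → g (outside ∷ A))
    g₁ = sumSubsets n (λ A → g (inside ∷ A))
    +-transpose : ∀ a b c d → (a + b) + (c + d) ≡ (a + c) + (b + d)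
    +-transpose = solve-∀

  sumSubsets-zero : ∀ n → sumSubsets n (λ _ → 0) ≡ 0
  sumSubsets-zero zero    = refl
  sumSubsets-zero (suc n) = cong₂ _+_ (sumSubsets-zero n) (sumSubsets-zero n)

  sumSubsets-∁ : ∀ n (f : Subset n → ℕ) → sumSubsets n (λ A → f (∁ A)) ≡ sumSubsets n f
  sumSubsets-∁ zero    f = refl
  sumSubsets-∁ (suc n) f =
    trans (cong₂ _+_ (sumSubsets-∁ n (λ A → f (inside ∷ A))) (sumSubsets-∁ n (λ A → f (outside ∷ A))))
          (+-comm (sumSubsets n (λ A → f (inside ∷ A))) _)

  ∁-involutive : ∀ {n} (A : Subset n) → ∁ (∁ A) ≡ A
  ∁-involutive {n} = BooleanAlgebraProperties.¬-involutive (∪-∩-booleanAlgebra n)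

  ∣A∣+∣∁A∣≡n : ∀ {n} (A : Subset n) → ∣ A ∣ + ∣ ∁ A ∣ ≡ n
  ∣A∣+∣∁A∣≡n A = trans (cong (∣ A ∣ +_) (∣∁p∣≡n∸∣p∣ A)) (m+[n∸m]≡n (∣p∣≤n A))

  _≟ˢ_ : ∀ {n} (A B : Subset n) → Dec (A ≡ B)
  _≟ˢ_ = ≡-dec _≟ᵇ_

  _∈ᵇ_ : ∀ {n} → Subset n → List (Subset n) → Bool
  A ∈ᵇ F = does (any? (A ≟ˢ_) F)

  ∈ᵇ-sound : ∀ {n} (A : Subset n) F → A ∈ᵇ F ≡ true → A ∈ F
  ∈ᵇ-sound A F A∈ᵇF with any? (A ≟ˢ_) F
  ... | yes A∈F = A∈F

  sumSubsets-point : ∀ n (x : Subset n) (g : Subset n → ℕ) →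
    sumSubsets n (λ A → [ does (A ≟ˢ x) ]· g A) ≡ g x
  sumSubsets-point zero    []            g = refl
  sumSubsets-point (suc n) (outside ∷ x) g =
    trans (cong₂ _+_ (sumSubsets-point n x (λ A → g (outside ∷ A))) (sumSubsets-zero n)) (+-identityʳ _)
  sumSubsets-point (suc n) (inside ∷ x)  g =
    cong₂ _+_ (sumSubsets-zero n) (sumSubsets-point n x (λ A → g (inside ∷ A)))

  sumList-indicator : ∀ n (g : Subset n → ℕ) F → Unique F →
    sum (map g F) ≡ sumSubsets n (λ A → [ A ∈ᵇ F ]· g A)
  sumList-indicator n g []       []                 = sym (sumSubsets-zero n)
  sumList-indicator n g (x ∷ xs) (x∉xs ∷ uniqueXs) = begin
    g x + sum (map g xs)
      ≡⟨ cong₂ _+_ (sym (sumSubsets-point n x g)) (sumList-indicator n g xs uniqueXs) ⟩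
    sumSubsets n (λ A → [ does (A ≟ˢ x) ]· g A) + sumSubsets n (λ A → [ A ∈ᵇ xs ]· g A)
      ≡⟨ sumSubsets-+ n _ _ ⟨
    sumSubsets n (λ A → [ does (A ≟ˢ x) ]· g A + [ A ∈ᵇ xs ]· g A)
      ≡⟨ sumSubsets-cong n disjoint ⟨
    sumSubsets n (λ A → [ does (A ≟ˢ x) ∨ A ∈ᵇ xs ]· g A)
      ∎
    where
    open ≡-Reasoning
    disjoint : ∀ A → [ does (A ≟ˢ x) ∨ A ∈ᵇ xs ]· g A ≡ [ does (A ≟ˢ x) ]· g A + [ A ∈ᵇ xs ]· g A
    disjoint A with A ≟ˢ x
    ... | no _ = refl
    ... | yes refl with any? (x ≟ˢ_) xs
    ...   | no _     = sym (+-identityʳ (g x))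
    ...   | yes x∈xs = contradiction x∈xs (All¬⇒¬Any x∉xs)

  Shattersᵇ : ∀ {n} → (Subset n → Bool) → Subset n → Set
  Shattersᵇ χ R = ∀ S → S ⊆ R → ∃ λ A → χ A ≡ true × A ∩ R ≡ S

  shatters-[] : (χ : Subset 0 → Bool) → χ [] ≡ true → Shattersᵇ χ []
  shatters-[] χ χ[] [] _ = [] , χ[] , refl

  shatters-outside : ∀ {n} (χ : Subset (suc n) → Bool) R →
    Shattersᵇ (λ A → χ (outside ∷ A) ∨ χ (inside ∷ A)) R → Shattersᵇ χ (outside ∷ R)
  shatters-outside χ R sh (inside ∷ S) S⊆R = contradiction (S⊆R here) λ ()
  shatters-outside χ R sh (outside ∷ S) S⊆R with sh S (drop-∷-⊆ S⊆R)
  ... | A , χ₀A∨χ₁A , A∩R≡S with χ (outside ∷ A) in χ₀A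
  ...   | true  = outside ∷ A , χ₀A , cong (outside ∷_) A∩R≡S
  ...   | false = inside ∷ A , χ₀A∨χ₁A , cong (outside ∷_) A∩R≡S

  shatters-inside : ∀ {n} (χ : Subset (suc n) → Bool) R →
    Shattersᵇ (λ A → χ (outside ∷ A) ∧ χ (inside ∷ A)) R → Shattersᵇ χ (inside ∷ R)
  shatters-inside χ R sh (s ∷ S) S⊆R with sh S (drop-∷-⊆ S⊆R)
  ... | A , χ₀A∧χ₁A , A∩R≡S with χ (outside ∷ A) in χ₀A | χ (inside ∷ A) in χ₁A | s
  ...   | true | true | outside = outside ∷ A , χ₀A , cong (outside ∷_) A∩R≡S
  ...   | true | true | inside  = inside ∷ A , χ₁A , cong (inside ∷_) A∩R≡S

  ∁-trace-bit : ∀ a s r → (s ≡ true → r ≡ true) → a ∧ r ≡ not s ∧ r → not a ∧ r ≡ s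
  ∁-trace-bit a     false false _   _  = ∧-zeroʳ (not a)
  ∁-trace-bit _     true  false s⊆r _  = contradiction (s⊆r refl) λ ()
  ∁-trace-bit true  false true  _   _  = refl
  ∁-trace-bit false false true  _   ()
  ∁-trace-bit true  true  true  _   ()
  ∁-trace-bit false true  true  _   _  = refl

  ∁-trace : ∀ {n} (A S R : Subset n) → S ⊆ R → A ∩ R ≡ ∁ S ∩ R → ∁ A ∩ R ≡ S
  ∁-trace []      []      []      _   _  = refl
  ∁-trace (a ∷ A) (s ∷ S) (r ∷ R) S⊆R eq =
    cong₂ _∷_ (∁-trace-bit a s r head⊆ (proj₁ (∷-injective eq)))
              (∁-trace A S R (drop-∷-⊆ S⊆R) (proj₂ (∷-injective eq)))
    where
    head⊆ : s ≡ true → r ≡ true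
    head⊆ refl with S⊆R here
    ... | here = refl

  shatters-∁ : ∀ {n} (χ : Subset n → Bool) R → Shattersᵇ (λ A → χ (∁ A)) R → Shattersᵇ χ R
  shatters-∁ χ R sh S S⊆R with sh (∁ S ∩ R) (p∩q⊆q (∁ S) R)
  ... | A , χ∁A , A∩R≡∁S∩R = ∁ A , χ∁A , ∁-trace A S R S⊆R A∩R≡∁S∩R

  shattersᵇ⇒shatters : ∀ {n} (F : List (Subset n)) R → Shattersᵇ (_∈ᵇ F) R → Shatters F R
  shattersᵇ⇒shatters F R sh S S⊆R with sh S S⊆R
  ... | A , A∈ᵇF , A∩R≡S = A , ∈ᵇ-sound A F A∈ᵇF , A∩R≡S

  Antitone : ∀ {n} → (Subset n → ℕ) → Set
  Antitone w = ∀ {A B} → A ⊆ B → w B ≤ w A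

  -- Induction on n splits χ by the first point into
  -- χ₀, χ₁ and replaces them by χ₀ ∨ χ₁ (weighted without the point) and
  -- χ₀ ∧ χ₁ (weighted with it), which by antitonicity does not lose weight.
  weightedPajor : ∀ n (w : Subset n → ℕ) → Antitone w → (χ T : Subset n → Bool) →
    (∀ R → Shattersᵇ χ R → T R ≡ true) →
    sumSubsets n (λ A → [ χ A ]· w A) ≤ sumSubsets n (λ R → [ T R ]· w R)
  weightedPajor zero w _ χ T shattered⇒T with χ [] in χ[]
  ... | true rewrite shattered⇒T [] (shatters-[] χ χ[]) = ≤-refl
  ... | false = z≤n
  weightedPajor (suc n) w antitone χ T shattered⇒T = begin
    sumSubsets n (λ A → [ χ₀ A ]· w₀ A) + sumSubsets n (λ A → [ χ₁ A ]· w₁ A)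
      ≡⟨ sumSubsets-+ n _ _ ⟨
    sumSubsets n (λ A → [ χ₀ A ]· w₀ A + [ χ₁ A ]· w₁ A)
      ≤⟨ sumSubsets-mono n (λ A → []·-exchange (χ₀ A) (χ₁ A) (antitone (out⊆ ⊆-refl))) ⟩
    sumSubsets n (λ A → [ χ₀ A ∨ χ₁ A ]· w₀ A + [ χ₀ A ∧ χ₁ A ]· w₁ A)
      ≡⟨ sumSubsets-+ n _ _ ⟩
    sumSubsets n (λ A → [ χ₀ A ∨ χ₁ A ]· w₀ A) + sumSubsets n (λ A → [ χ₀ A ∧ χ₁ A ]· w₁ A)
      ≤⟨ +-mono-≤ (weightedPajor n w₀ (λ A⊆B → antitone (s⊆s A⊆B)) _ (λ R → T (outside ∷ R))
                    (λ R sh → shattered⇒T (outside ∷ R) (shatters-outside χ R sh)))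
                  (weightedPajor n w₁ (λ A⊆B → antitone (s⊆s A⊆B)) _ (λ R → T (inside ∷ R))
                    (λ R sh → shattered⇒T (inside ∷ R) (shatters-inside χ R sh))) ⟩
    sumSubsets n (λ R → [ T (outside ∷ R) ]· w₀ R) + sumSubsets n (λ R → [ T (inside ∷ R) ]· w₁ R)
      ∎
    where
    open ≤-Reasoning
    χ₀ χ₁ : Subset n → Bool
    χ₀ A = χ (outside ∷ A)
    χ₁ A = χ (inside ∷ A)
    w₀ w₁ : Subset n → ℕ
    w₀ A = w (outside ∷ A)
    w₁ A = w (inside ∷ A)

  sizeWeight : ∀ {n} → (ℕ → ℕ → ℕ) → Subset n → ℕ
  sizeWeight φ A = φ ∣ A ∣ ∣ ∁ A ∣

  sizeWeight-antitone : ∀ {n} (φ : ℕ → ℕ → ℕ) → (∀ a b → φ (suc a) b ≤ φ a (suc b)) →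
    Antitone (sizeWeight {n} φ)
  sizeWeight-antitone φ shift {[]}          {[]}          _   = ≤-refl
  sizeWeight-antitone φ shift {outside ∷ A} {outside ∷ B} A⊆B =
    sizeWeight-antitone (λ a b → φ a (suc b)) (λ a b → shift a (suc b)) (drop-∷-⊆ A⊆B)
  sizeWeight-antitone φ shift {inside ∷ A}  {inside ∷ B}  A⊆B =
    sizeWeight-antitone (λ a b → φ (suc a) b) (λ a b → shift (suc a) b) (drop-∷-⊆ A⊆B)
  sizeWeight-antitone φ shift {outside ∷ A} {inside ∷ B}  A⊆B =
    ≤-trans (sizeWeight-antitone (λ a b → φ (suc a) b) (λ a b → shift (suc a) b) (drop-∷-⊆ A⊆B))
            (shift ∣ A ∣ ∣ ∁ A ∣)
  sizeWeight-antitone φ shift {inside ∷ A}  {outside ∷ B} A⊆B = contradiction (A⊆B here) λ ()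

  -- lowerTail a b is the number of subsets with at most b elements of a set with
  -- a + b + 1 elements, i.e. Σ_{j ≤ b} C(a+b+1, j); it is defined by Pascal's rule.
  lowerTail : ℕ → ℕ → ℕ
  lowerTail a       zero    = 1
  lowerTail zero    (suc b) = 2 * lowerTail zero b + 1
  lowerTail (suc a) (suc b) = lowerTail a (suc b) + lowerTail (suc a) b

  lowerTail-positive : ∀ a b → 0 < lowerTail a b
  lowerTail-positive a       zero    = s≤s z≤n
  lowerTail-positive zero    (suc b) = m≤n+m 1 (2 * lowerTail 0 b)
  lowerTail-positive (suc a) (suc b) = <-≤-trans (lowerTail-positive a (suc b)) (m≤m+n _ _)

  -- With a = 0 all subsets except the full one are counted.
  lowerTail-zeroˡ : ∀ b → lowerTail 0 b + 1 ≡ 2 ^ suc b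
  lowerTail-zeroˡ zero    = refl
  lowerTail-zeroˡ (suc b) = trans (double-plus-two (lowerTail 0 b)) (cong (2 *_) (lowerTail-zeroˡ b))
    where
    double-plus-two : ∀ x → 2 * x + 1 + 1 ≡ 2 * (x + 1)
    double-plus-two = solve-∀

  -- With b = 1: the empty set and the a + 2 singletons.
  lowerTail-oneʳ : ∀ a → lowerTail a 1 ≡ 3 + a
  lowerTail-oneʳ zero    = refl
  lowerTail-oneʳ (suc a) = trans (cong (_+ 1) (lowerTail-oneʳ a)) (+-comm (3 + a) 1)

  -- Complementation in an (a+b+1)-set exchanges "at most b elements" with
  -- "at least b+1 elements", so the two tails partition the power set.
  lowerTail-symmetric : ∀ a b → lowerTail a b + lowerTail b a ≡ 2 ^ suc (a + b)
  lowerTail-symmetric zero    b       = lowerTail-zeroˡ b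
  lowerTail-symmetric (suc a) zero    =
    trans (+-comm 1 (lowerTail 0 (suc a)))
          (trans (lowerTail-zeroˡ (suc a)) (cong (λ m → 2 ^ suc m) (sym (+-identityʳ (suc a)))))
  lowerTail-symmetric (suc a) (suc b) = begin
    (lowerTail a (suc b) + lowerTail (suc a) b) + (lowerTail b (suc a) + lowerTail (suc b) a)
      ≡⟨ regroup (lowerTail a (suc b)) (lowerTail (suc a) b) (lowerTail b (suc a)) (lowerTail (suc b) a) ⟩
    (lowerTail a (suc b) + lowerTail (suc b) a) + (lowerTail (suc a) b + lowerTail b (suc a))
      ≡⟨ cong₂ _+_ (lowerTail-symmetric a (suc b)) (lowerTail-symmetric (suc a) b) ⟩
    2 ^ suc (a + suc b) + 2 ^ suc (suc a + b)
      ≡⟨ cong (λ m → 2 ^ suc m + 2 ^ suc (suc a + b)) (+-suc a b) ⟩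
    2 ^ suc (suc a + b) + 2 ^ suc (suc a + b)
      ≡⟨ cong (2 ^ suc (suc a + b) +_) (+-identityʳ (2 ^ suc (suc a + b))) ⟨
    2 ^ suc (suc (suc a + b))
      ≡⟨ cong (λ m → 2 ^ suc m) (+-suc (suc a) b) ⟨
    2 ^ suc (suc a + suc b)
      ∎
    where
    open ≡-Reasoning
    regroup : ∀ x y z u → (x + y) + (z + u) ≡ (x + u) + (y + z)
    regroup = solve-∀

  lowerTail-oneˡ≤ : ∀ b → lowerTail 1 b ≤ lowerTail 0 (suc b)
  lowerTail-oneˡ≤ zero    = s≤s z≤n
  lowerTail-oneˡ≤ (suc b) = begin
    lowerTail 0 (suc b) + lowerTail 1 b      ≤⟨ +-monoʳ-≤ (lowerTail 0 (suc b)) (lowerTail-oneˡ≤ b) ⟩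
    lowerTail 0 (suc b) + lowerTail 0 (suc b) ≤⟨ m≤m+n _ 1 ⟩
    lowerTail 0 (suc b) + lowerTail 0 (suc b) + 1
      ≡⟨ cong (λ x → lowerTail 0 (suc b) + x + 1) (+-identityʳ (lowerTail 0 (suc b))) ⟨
    2 * lowerTail 0 (suc b) + 1               ∎
    where open ≤-Reasoning

  -- The inductive step
  -- adds the instances at (a+1, b) and (a, b+1) after one use of Pascal's rule.
  lowerTail-shift : ∀ a b → suc a * lowerTail (suc a) b ≤ suc b * lowerTail a (suc b)
  lowerTail-shift zero    b       = begin
    1 * lowerTail 1 b          ≡⟨ *-identityˡ (lowerTail 1 b) ⟩
    lowerTail 1 b              ≤⟨ lowerTail-oneˡ≤ b ⟩
    lowerTail 0 (suc b)        ≤⟨ m≤n*m (lowerTail 0 (suc b)) (suc b) ⟩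
    suc b * lowerTail 0 (suc b) ∎
    where open ≤-Reasoning
  lowerTail-shift (suc a) zero    = begin
    suc (suc a) * 1            ≡⟨ *-identityʳ (suc (suc a)) ⟩
    suc (suc a)                ≤⟨ m≤n+m (suc (suc a)) 2 ⟩
    3 + suc a                  ≡⟨ lowerTail-oneʳ (suc a) ⟨
    lowerTail (suc a) 1        ≡⟨ *-identityˡ (lowerTail (suc a) 1) ⟨
    1 * lowerTail (suc a) 1    ∎
    where open ≤-Reasoning
  lowerTail-shift (suc a) (suc b) = begin
    suc (suc a) * (p + q)
      ≡⟨ expandˡ (suc a) p q ⟩
    p + (suc a * p + suc (suc a) * q)
      ≤⟨ +-monoʳ-≤ p (+-mono-≤ (lowerTail-shift a (suc b)) (lowerTail-shift (suc a) b)) ⟩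
    p + (suc (suc b) * r + suc b * p)
      ≡⟨ collectʳ (suc b) p r ⟩
    suc (suc b) * (r + p)
      ∎
    where
    open ≤-Reasoning
    p = lowerTail (suc a) (suc b)
    q = lowerTail (suc (suc a)) b
    r = lowerTail a (suc (suc b))
    expandˡ : ∀ a p q → suc a * (p + q) ≡ p + (a * p + suc a * q)
    expandˡ = solve-∀
    collectʳ : ∀ b p r → p + (suc b * r + b * p) ≡ suc b * (r + p)
    collectʳ = solve-∀

  layerWeight : ℕ → ℕ → ℕ
  layerWeight a b = a ! * b ! * lowerTail a b

  layerWeight-positive : ∀ a b → 0 < layerWeight a b
  layerWeight-positive a b = *-mono-≤ (*-mono-≤ (1≤n! a) (1≤n! b)) (lowerTail-positive a b)

  layerWeight-shift : ∀ a b → layerWeight (suc a) b ≤ layerWeight a (suc b)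
  layerWeight-shift a b = begin
    (suc a * a !) * b ! * lowerTail (suc a) b
      ≡⟨ reassoc (suc a) (a !) (b !) (lowerTail (suc a) b) ⟩
    a ! * b ! * (suc a * lowerTail (suc a) b)
      ≤⟨ *-monoʳ-≤ (a ! * b !) (lowerTail-shift a b) ⟩
    a ! * b ! * (suc b * lowerTail a (suc b))
      ≡⟨ reassoc′ (suc b) (a !) (b !) (lowerTail a (suc b)) ⟩
    a ! * (suc b * b !) * lowerTail a (suc b)
      ∎
    where
    open ≤-Reasoning
    reassoc : ∀ c x y p → c * x * y * p ≡ x * y * (c * p)
    reassoc = solve-∀
    reassoc′ : ∀ c x y p → x * y * (c * p) ≡ x * (c * y) * p
    reassoc′ = solve-∀

  layerWeight-symmetric : ∀ a b → layerWeight a b + layerWeight b a ≡ 2 ^ suc (a + b) * (a ! * b !)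
  layerWeight-symmetric a b = begin
    a ! * b ! * lowerTail a b + b ! * a ! * lowerTail b a
      ≡⟨ factor (a !) (b !) (lowerTail a b) (lowerTail b a) ⟩
    (lowerTail a b + lowerTail b a) * (a ! * b !)
      ≡⟨ cong (_* (a ! * b !)) (lowerTail-symmetric a b) ⟩
    2 ^ suc (a + b) * (a ! * b !)
      ∎
    where
    open ≡-Reasoning
    factor : ∀ x y p q → x * y * p + y * x * q ≡ (p + q) * (x * y)
    factor = solve-∀

  lymWeight : ∀ {n} → Subset n → ℕ
  lymWeight = sizeWeight layerWeight

  lymWeight-antitone : ∀ {n} → Antitone (lymWeight {n})
  lymWeight-antitone = sizeWeight-antitone layerWeight layerWeight-shift

  lymWeight-positive : ∀ {n} (A : Subset n) → 0 < lymWeight A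
  lymWeight-positive A = layerWeight-positive ∣ A ∣ ∣ ∁ A ∣

  pairWeight : ∀ {n} → Subset n → ℕ
  pairWeight A = lymWeight A + lymWeight (∁ A)

  pairWeight-factorials : ∀ {n} (A : Subset n) → pairWeight A ≡ 2 ^ suc n * (∣ A ∣ ! * ∣ ∁ A ∣ !)
  pairWeight-factorials {n} A = begin
    layerWeight k l + layerWeight l (∣ ∁ (∁ A) ∣)
      ≡⟨ cong (λ B → layerWeight k l + layerWeight l (∣ B ∣)) (∁-involutive A) ⟩
    layerWeight k l + layerWeight l k
      ≡⟨ layerWeight-symmetric k l ⟩
    2 ^ suc (k + l) * (k ! * l !)
      ≡⟨ cong (λ m → 2 ^ suc m * (k ! * l !)) (∣A∣+∣∁A∣≡n A) ⟩
    2 ^ suc n * (k ! * l !)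
      ∎
    where
    open ≡-Reasoning
    k l : ℕ
    k = ∣ A ∣
    l = ∣ ∁ A ∣

  denominator : ℕ → ℕ
  denominator n = 2 ^ suc n * n !

  denominator-suc : ∀ n → ∃ λ D′ → denominator n ≡ suc D′
  denominator-suc n with denominator n | *-mono-≤ (m^n>0 2 (suc n)) (1≤n! n)
  ... | suc D′ | _ = D′ , refl

  binomial-factorials : ∀ {n k} → k ≤ n → (n C k) * (k ! * (n ∸ k) !) ≡ n !
  binomial-factorials {n} {k} k≤n =
    trans (cong (_* (k ! * (n ∸ k) !)) (nCk≡n!/k![n-k]! k≤n))
          (m/n*n≡m {{k !* (n ∸ k) !≢0}} (k![n∸k]!∣n! k≤n))

  pairWeight-binomial : ∀ {n} (A : Subset n) → pairWeight A * (n C ∣ A ∣) ≡ denominator n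
  pairWeight-binomial {n} A = begin
    pairWeight A * (n C ∣ A ∣)
      ≡⟨ cong (_* (n C ∣ A ∣)) (pairWeight-factorials A) ⟩
    2 ^ suc n * (∣ A ∣ ! * ∣ ∁ A ∣ !) * (n C ∣ A ∣)
      ≡⟨ cong (λ m → 2 ^ suc n * (∣ A ∣ ! * m !) * (n C ∣ A ∣)) (∣∁p∣≡n∸∣p∣ A) ⟩
    2 ^ suc n * (∣ A ∣ ! * (n ∸ ∣ A ∣) !) * (n C ∣ A ∣)
      ≡⟨ reorder (2 ^ suc n) (∣ A ∣ ! * (n ∸ ∣ A ∣) !) (n C ∣ A ∣) ⟩
    2 ^ suc n * ((n C ∣ A ∣) * (∣ A ∣ ! * (n ∸ ∣ A ∣) !))
      ≡⟨ cong (2 ^ suc n *_) (binomial-factorials (∣p∣≤n A)) ⟩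
    2 ^ suc n * n !
      ∎
    where
    open ≡-Reasoning
    reorder : ∀ p f c → p * f * c ≡ p * (c * f)
    reorder = solve-∀

  -- Pascal's rule C(n,k+1) + C(n,k) = C(n+1,k+1), with each term weighted by a
  -- function of the complement size of its k-sets (n ∸ k grows by one when a
  -- new point is left out).
  pascal-weighted : ∀ n k (g : ℕ → ℕ) →
    (n C suc k) * g (suc (n ∸ suc k)) + (n C k) * g (n ∸ k) ≡ (suc n C suc k) * g (n ∸ k)
  pascal-weighted n k g with k <? n
  ... | yes k<n = begin
    (n C suc k) * g (suc (n ∸ suc k)) + (n C k) * g (n ∸ k)
      ≡⟨ cong (λ m → (n C suc k) * g m + (n C k) * g (n ∸ k)) (+-∸-assoc 1 k<n) ⟨
    (n C suc k) * g (n ∸ k) + (n C k) * g (n ∸ k)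
      ≡⟨ *-distribʳ-+ (g (n ∸ k)) (n C suc k) (n C k) ⟨
    (n C suc k + n C k) * g (n ∸ k)
      ≡⟨ cong (_* g (n ∸ k)) (trans (+-comm (n C suc k) (n C k)) (nCk+nC[k+1]≡[n+1]C[k+1] n k)) ⟩
    (suc n C suc k) * g (n ∸ k)
      ∎
    where open ≡-Reasoning
  ... | no k≮n = begin
    (n C suc k) * g (suc (n ∸ suc k)) + (n C k) * g (n ∸ k)
      ≡⟨ cong (λ c → c * g (suc (n ∸ suc k)) + (n C k) * g (n ∸ k)) nC[k+1]≡0 ⟩
    (n C k) * g (n ∸ k)
      ≡⟨ cong (_* g (n ∸ k)) (trans (cong (n C k +_) nC[k+1]≡0) (+-identityʳ (n C k))) ⟨
    (n C k + n C suc k) * g (n ∸ k)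
      ≡⟨ cong (_* g (n ∸ k)) (nCk+nC[k+1]≡[n+1]C[k+1] n k) ⟩
    (suc n C suc k) * g (n ∸ k)
      ∎
    where
    open ≡-Reasoning
    nC[k+1]≡0 : n C suc k ≡ 0
    nC[k+1]≡0 = k>n⇒nCk≡0 (s≤s (≮⇒≥ k≮n))

  layerCount : ∀ n k (h : ℕ → ℕ → ℕ) →
    sumSubsets n (λ R → [ ∣ R ∣ ≡ᵇ k ]· sizeWeight h R) ≡ (n C k) * h k (n ∸ k)
  layerCount zero    zero    h = sym (+-identityʳ (h 0 0))
  layerCount zero    (suc k) h = refl
  layerCount (suc n) zero    h =
    trans (cong₂ _+_ (layerCount n 0 (λ a b → h a (suc b))) (sumSubsets-zero n)) (+-identityʳ _)
  layerCount (suc n) (suc k) h =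
    trans (cong₂ _+_ (layerCount n (suc k) (λ a b → h a (suc b))) (layerCount n k (λ a b → h (suc a) b)))
          (pascal-weighted n k (h (suc k)))

  layerBound : ∀ n k → (n C k) * (2 ^ suc n * (k ! * (n ∸ k) !)) ≤ denominator n
  layerBound n k with k ≤? n
  ... | yes k≤n = ≤-reflexive (trans (reorder (n C k) (2 ^ suc n) (k ! * (n ∸ k) !))
                                     (cong (2 ^ suc n *_) (binomial-factorials k≤n)))
    where
    reorder : ∀ c p f → c * (p * f) ≡ p * (c * f)
    reorder = solve-∀
  ... | no k≰n rewrite k>n⇒nCk≡0 {n} {k} (≰⇒> k≰n) = z≤n

  <ᵇ-suc-split : ∀ m d x → [ m <ᵇ suc d ]· x ≡ [ m <ᵇ d ]· x + [ m ≡ᵇ d ]· x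
  <ᵇ-suc-split zero    zero    x = refl
  <ᵇ-suc-split zero    (suc d) x = sym (+-identityʳ x)
  <ᵇ-suc-split (suc m) zero    x = refl
  <ᵇ-suc-split (suc m) (suc d) x = <ᵇ-suc-split m d x

  <⇒<ᵇ≡true : ∀ {m d} → m < d → (m <ᵇ d) ≡ true
  <⇒<ᵇ≡true m<d = Equivalence.to T-≡ (<⇒<ᵇ m<d)

  -- The sets of size below d carry total pair weight at most d · 2ⁿ⁺¹ n!,
  -- since each layer contributes at most one unit 2ⁿ⁺¹ n!.
  belowSum : ∀ n d → sumSubsets n (λ R → [ ∣ R ∣ <ᵇ d ]· pairWeight R) ≤ d * denominator n
  belowSum n zero    = ≤-reflexive (sumSubsets-zero n)
  belowSum n (suc d) = begin
    sumSubsets n (λ R → [ ∣ R ∣ <ᵇ suc d ]· pairWeight R)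
      ≡⟨ sumSubsets-cong n (λ R → <ᵇ-suc-split ∣ R ∣ d (pairWeight R)) ⟩
    sumSubsets n (λ R → [ ∣ R ∣ <ᵇ d ]· pairWeight R + [ ∣ R ∣ ≡ᵇ d ]· pairWeight R)
      ≡⟨ sumSubsets-+ n _ _ ⟩
    sumSubsets n (λ R → [ ∣ R ∣ <ᵇ d ]· pairWeight R) + sumSubsets n (λ R → [ ∣ R ∣ ≡ᵇ d ]· pairWeight R)
      ≡⟨ cong (sumSubsets n (λ R → [ ∣ R ∣ <ᵇ d ]· pairWeight R) +_)
              (sumSubsets-cong n (λ R → cong ([ ∣ R ∣ ≡ᵇ d ]·_) (pairWeight-factorials R))) ⟩
    sumSubsets n (λ R → [ ∣ R ∣ <ᵇ d ]· pairWeight R) + sumSubsets n (λ R → [ ∣ R ∣ ≡ᵇ d ]· sizeWeight h R)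
      ≡⟨ cong (sumSubsets n (λ R → [ ∣ R ∣ <ᵇ d ]· pairWeight R) +_) (layerCount n d h) ⟩
    sumSubsets n (λ R → [ ∣ R ∣ <ᵇ d ]· pairWeight R) + (n C d) * h d (n ∸ d)
      ≤⟨ +-mono-≤ (belowSum n d) (layerBound n d) ⟩
    d * denominator n + denominator n
      ≡⟨ +-comm (d * denominator n) (denominator n) ⟩
    suc d * denominator n
      ∎
    where
    open ≤-Reasoning
    h : ℕ → ℕ → ℕ
    h a b = 2 ^ suc n * (a ! * b !)

  -- Split each pair weight into w(A) + w(∁A); both halves are bounded by the
  -- weighted Pajor lemma (the second via the complemented family), and the
  -- resulting weight of the small sets is strictly below the count of belowSum
  -- because the empty set's complement has positive weight.
  pairWeightSum-bound : ∀ n d → 0 < d → (χ : Subset n → Bool) → (∀ R → Shattersᵇ χ R → ∣ R ∣ < d) →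
    sumSubsets n (λ A → [ χ A ]· pairWeight A) < 2 * (d * denominator n)
  pairWeightSum-bound n d 0<d χ shattered⇒small = begin-strict
    sumSubsets n (λ A → [ χ A ]· pairWeight A)
      ≡⟨ sumSubsets-cong n (λ A → []·-distrib-+ (χ A) (lymWeight A) (lymWeight (∁ A))) ⟩
    sumSubsets n (λ A → [ χ A ]· lymWeight A + [ χ A ]· lymWeight (∁ A))
      ≡⟨ sumSubsets-+ n _ _ ⟩
    sumSubsets n (λ A → [ χ A ]· lymWeight A) + sumSubsets n (λ A → [ χ A ]· lymWeight (∁ A))
      ≡⟨ cong (sumSubsets n (λ A → [ χ A ]· lymWeight A) +_) reindex ⟩
    sumSubsets n (λ A → [ χ A ]· lymWeight A) + sumSubsets n (λ B → [ χ (∁ B) ]· lymWeight B)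
      ≤⟨ +-mono-≤ (pajor χ shattered⇒small)
                  (pajor (λ B → χ (∁ B)) (λ R sh → shattered⇒small R (shatters-∁ χ R sh))) ⟩
    smallWeight + smallWeight
      <⟨ +-mono-< smallWeight<bound smallWeight<bound ⟩
    d * denominator n + d * denominator n
      ≡⟨ cong (d * denominator n +_) (+-identityʳ (d * denominator n)) ⟨
    2 * (d * denominator n)
      ∎
    where
    open ≤-Reasoning
    small : Subset n → Bool
    small R = ∣ R ∣ <ᵇ d
    smallWeight : ℕ
    smallWeight = sumSubsets n (λ R → [ small R ]· lymWeight R)
    pajor : (ψ : Subset n → Bool) → (∀ R → Shattersᵇ ψ R → ∣ R ∣ < d) →
      sumSubsets n (λ A → [ ψ A ]· lymWeight A) ≤ smallWeight
    pajor ψ hyp = weightedPajor n lymWeight lymWeight-antitone ψ small (λ R sh → <⇒<ᵇ≡true (hyp R sh))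
    reindex : sumSubsets n (λ A → [ χ A ]· lymWeight (∁ A)) ≡ sumSubsets n (λ B → [ χ (∁ B) ]· lymWeight B)
    reindex = trans (sumSubsets-cong n (λ A → cong (λ Z → [ χ Z ]· lymWeight (∁ A)) (sym (∁-involutive A))))
                    (sumSubsets-∁ n (λ B → [ χ (∁ B) ]· lymWeight B))
    ∅ : Subset n
    ∅ = ⊥
    strictAtEmpty : [ small ∅ ]· lymWeight ∅ < [ small ∅ ]· pairWeight ∅
    strictAtEmpty = []·-strict (<⇒<ᵇ≡true (subst (_< d) (sym (∣⊥∣≡0 n)) 0<d))
                               (m<m+n (lymWeight ∅) (lymWeight-positive (∁ ∅)))
    smallWeight<bound : smallWeight < d * denominator n
    smallWeight<bound =
      <-≤-trans (sumSubsets-strict n (λ R → []·-mono (small R) (m≤m+n _ _)) strictAtEmpty) (belowSum n d)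

  pairWeightList-bound : ∀ n d → 0 < d → (F : List (Subset n)) → Unique F → VCdimLessThan F d →
    sum (map pairWeight F) < 2 * d * denominator n
  pairWeightList-bound n d 0<d F unique vcdim = begin-strict
    sum (map pairWeight F)
      ≡⟨ sumList-indicator n pairWeight F unique ⟩
    sumSubsets n (λ A → [ A ∈ᵇ F ]· pairWeight A)
      <⟨ pairWeightSum-bound n d 0<d (_∈ᵇ F) (λ R sh → vcdim R (shattersᵇ⇒shatters F R sh)) ⟩
    2 * (d * denominator n)
      ≡⟨ *-assoc 2 d (denominator n) ⟨
    2 * d * denominator n
      ∎
    where open ≤-Reasoning

module LYMFraction where

  open import Data.Nat using (ℕ; zero; suc; _+_; _*_; _<_)
  open import Data.Nat.Properties using (*-zeroʳ; *-identityʳ; +-identityʳ)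
  open import Data.Nat.Combinatorics using (_C_)
  open import Data.Nat.ListAction using (sum)
  open import Data.List using (List; []; _∷_; map)
  open import Data.Fin.Subset using (Subset; ∣_∣)
  open import Relation.Nullary using (contradiction)
  open import Relation.Binary.PropositionalEquality
  open import Data.Integer using (+_; _◃_)
  import Data.Sign as Sign
  import Data.Integer as ℤ
  import Data.Integer.Properties as ℤ
  import Data.Integer.Tactic.RingSolver as ℤ-Solver
  open import Data.Rational using (toℚᵘ)
  open import Data.Rational.Properties using (toℚᵘ-fromℚᵘ; toℚᵘ-homo-+)
  open import Data.Rational.Unnormalised using (mkℚᵘ; _≃_; *≡*; *<*)
  import Data.Rational.Unnormalised as ℚᵘ
  import Data.Rational.Unnormalised.Properties as ℚᵘ

  open import Defs
  open WeightedShattering using (denominator; pairWeight; pairWeight-binomial)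

  -- mkℚᵘ (+ a) p is the fraction a / (p+1); equality, sums and comparisons of
  -- such fractions reduce to natural-number arithmetic.
  fraction-≃ : ∀ a p c q → a * suc q ≡ c * suc p → mkℚᵘ (+ a) p ≃ mkℚᵘ (+ c) q
  fraction-≃ a p c q cross = *≡* (cong (Sign.+ ◃_) cross)

  fraction-+ : ∀ a b D′ → mkℚᵘ (+ a) D′ ℚᵘ.+ mkℚᵘ (+ b) D′ ≃ mkℚᵘ (+ (a + b)) D′
  fraction-+ a b D′ = *≡* (trans (common (+ a) (+ b) (+ suc D′))
                                 (cong₂ ℤ._*_ (sym (ℤ.pos-+ a b)) (sym (ℤ.pos-* (suc D′) (suc D′)))))
    where
    common : ∀ x y z → (x ℤ.* z ℤ.+ y ℤ.* z) ℤ.* z ≡ (x ℤ.+ y) ℤ.* (z ℤ.* z)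
    common = ℤ-Solver.solve-∀

  recip-as-fraction : ∀ c a D′ → a * c ≡ suc D′ → toℚᵘ (recip c) ≃ mkℚᵘ (+ a) D′
  recip-as-fraction zero    a D′ a*0≡D = contradiction (trans (sym (*-zeroʳ a)) a*0≡D) λ ()
  recip-as-fraction (suc c) a D′ a*c≡D =
    ℚᵘ.≃-trans (toℚᵘ-fromℚᵘ (mkℚᵘ (+ 1) c)) (fraction-≃ 1 c a D′ (trans (+-identityʳ (suc D′)) (sym a*c≡D)))

  ℓ-as-fraction : ∀ {n} (F : List (Subset n)) D′ → denominator n ≡ suc D′ →
    toℚᵘ (ℓ F) ≃ mkℚᵘ (+ sum (map pairWeight F)) D′
  ℓ-as-fraction []       D′ _   = *≡* refl
  ℓ-as-fraction {n} (A ∷ F) D′ D≡ =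
    ℚᵘ.≃-trans (toℚᵘ-homo-+ (recip (n C ∣ A ∣)) (ℓ F))
      (ℚᵘ.≃-trans (ℚᵘ.+-cong (recip-as-fraction (n C ∣ A ∣) (pairWeight A) D′ (trans (pairWeight-binomial A) D≡))
                             (ℓ-as-fraction F D′ D≡))
                  (fraction-+ (pairWeight A) (sum (map pairWeight F)) D′))

  fraction-< : ∀ a b D′ → a < b * suc D′ → mkℚᵘ (+ a) D′ ℚᵘ.< mkℚᵘ (+ b) 0
  fraction-< a b D′ a<bD = *<* (ℤ.+◃-mono-< (subst (_< b * suc D′) (sym (*-identityʳ a)) a<bD))

open import Defs
open import Data.Nat using (ℕ; NonZero; _*_; suc; >-nonZero⁻¹)
import Data.Nat as ℕ
open import Data.Integer using (+_)
open import Data.Rational using (_<_; _/_; toℚᵘ)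
open import Data.Fin.Subset using (Subset)
open import Data.List using (List; map)
open import Data.List.Relation.Unary.Unique.Propositional using (Unique)
open import Data.Nat.ListAction using (sum)
open import Data.Product using (_,_)
open import Data.Rational.Properties using (toℚᵘ-fromℚᵘ; toℚᵘ-cancel-<)
open import Data.Rational.Unnormalised using (mkℚᵘ)
open import Data.Rational.Unnormalised.Properties using (module ≤-Reasoning)
open import Relation.Binary.PropositionalEquality using (subst)
open WeightedShattering using (denominator; denominator-suc; pairWeight; pairWeightList-bound)
open LYMFraction using (ℓ-as-fraction; fraction-<)

corollary3p5 : (n d : ℕ) → .{{_ : NonZero d}} → (F : List (Subset n)) → Unique F →
    VCdimLessThan F d → ℓ F < (+ (2 * d)) / 1
corollary3p5 n d F unique vcdim with denominator-suc n
... | D′ , D≡ = toℚᵘ-cancel-< (begin-strict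
  toℚᵘ (ℓ F)                          ≃⟨ ℓ-as-fraction F D′ D≡ ⟩
  mkℚᵘ (+ sum (map pairWeight F)) D′  <⟨ fraction-< _ (2 * d) D′ numerator-bound ⟩
  mkℚᵘ (+ (2 * d)) 0                  ≃⟨ toℚᵘ-fromℚᵘ (mkℚᵘ (+ (2 * d)) 0) ⟨
  toℚᵘ ((+ (2 * d)) / 1)              ∎)
  where
  open ≤-Reasoning
  numerator-bound : sum (map pairWeight F) ℕ.< 2 * d * suc D′
  numerator-bound = subst (λ D → sum (map pairWeight F) ℕ.< 2 * d * D) D≡
                          (pairWeightList-bound n d (>-nonZero⁻¹ d) F unique vcdim)
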